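{- Let $P$ be a graded tree poset of height $k$, let $x\in P$ and let $a$ be a positive integer. Then the blowup $P(x,a)$ is a graded tree poset of height $k$.
   Context: All posets are finite. The Hasse diagram of a poset $P$ is the graph on $P$ joining $x$ and $y$ when one covers the other ($x$ covers $z$ if $x>z$ and no $y$ satisfies $x>y>z$). $P$ is a tree poset if its Hasse diagram is a tree; its height is the number of elements of a longest chain; it is graded if all maximal chains have the same number of elements. Blowup: for a tree poset $P$ with $|P|=m$, $x\in P$ and a positive integer $t$, fix an ordering $x=x_1,\dots,x_m$ of $P$ such that for each $i\ge 2$ the Hasse diagram induced on $\{x_1,\dots,x_i\}$ is a tree in which $x_i$ has degree $1$. Let $d(x_i)$ be the distance from $x$ to $x_i$ in the Hasse diagram. Replace each $x_i$ by $t^{d(x_i)}$ copies $x_{i,1},\dots,x_{i,t^{d(x_i)}}$. For each $i>1$ there is exactly one $j<i$ with $x_ix_j$ an edge of the Hasse diagram and $d(x_i)=d(x_j)+1$; split the copies of $x_i$ into the $t^{d(x_i)-1}$ sets $V_{i,r}=\{x_{i,(r-1)t+1},\dots,x_{i,rt}\}$, $r\in[t^{d(x_i)-1}]$. If $x_i$ covers $x_j$ in $P$, set $x_{j,r}<v$ for all $v\in V_{i,r}$; otherwise ($x_j$ covers $x_i$) set $x_{j,r}>v$ for all $v\in V_{i,r}$. $P(x,t)$ is the poset on all copies generated by these relations; it is unique up to isomorphism. -}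

module Defs where

open import Level using (0ℓ)
open import Data.Nat using (ℕ; _≤_)
open import Data.Fin using (Fin)
open import Data.Fin.Properties using (any?) renaming (_≟_ to _≟F_)
open import Data.Product using (Σ; ∃; _×_; _,_; proj₁)
open import Data.Product.Properties using () 
open import Data.Sum using (_⊎_)
open import Data.Empty using (⊥)
open import Data.List using (List; []; _∷_; length; map; _++_; [_])
open import Data.List.Membership.Propositional using (_∈_)
open import Data.List.Relation.Unary.Linked using (Linked; linked?)
import Data.List.Relation.Unary.Unique.Propositional as UP
import Data.List.Relation.Unary.Unique.DecPropositional as UDP
open import Relation.Nullary using (¬_; Dec; ¬?)
open import Relation.Nullary.Decidable using (True; _×-dec_; _⊎-dec_)
open import Relation.Binary using (Rel; Decidable; IsStrictPartialOrder)
open import Relation.Binary.PropositionalEquality using (_≡_)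
open import Relation.Binary.Construct.Closure.Transitive using (TransClosure)

module _ {A : Set} (_<_ : Rel A 0ℓ) where

  Covers : A → A → Set
  Covers a b = (a < b) × ¬ (Σ A λ z → (a < z) × (z < b))

  HasseAdj : A → A → Set
  HasseAdj a b = Covers a b ⊎ Covers b a

  lastOf : A → List A → A
  lastOf u []      = u
  lastOf u (w ∷ l) = lastOf w l

  HasseConnected : Set
  HasseConnected = ∀ u v → Σ (List A) λ l → Linked HasseAdj (u ∷ l) × lastOf u l ≡ v

  IsCycle : List A → Set
  IsCycle l = (3 ≤ length l) × Linked HasseAdj l × UP.Unique l ×
              Σ A λ v₁ → Σ (List A) λ r → (l ≡ v₁ ∷ r) × HasseAdj (lastOf v₁ r) v₁

  -- tree poset: the Hasse diagram is a tree (nonempty, connected, acyclic)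
  IsTreePoset : Set
  IsTreePoset = A × HasseConnected × (∀ l → ¬ IsCycle l)

  -- chains, listed in increasing order; number of elements = length
  IsChain : List A → Set
  IsChain = Linked _<_

  IsMaximalChain : List A → Set
  IsMaximalChain c = IsChain c ×
    (∀ c′ → IsChain c′ → (∀ z → z ∈ c → z ∈ c′) → ∀ z → z ∈ c′ → z ∈ c)

  HasHeight : ℕ → Set
  HasHeight k = (Σ (List A) λ c → IsChain c × length c ≡ k) ×
                (∀ c → IsChain c → length c ≤ k)

  IsGraded : Set
  IsGraded = ∀ c c′ → IsMaximalChain c → IsMaximalChain c′ → length c ≡ length c′

  IsGradedTreePosetOfHeight : ℕ → Set
  IsGradedTreePosetOfHeight k =
    IsStrictPartialOrder _≡_ _<_ × IsTreePoset × IsGraded × HasHeight k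

-- The copies of x_i are x_{i,r}, r ∈ [t^{d(x_i)}]; writing r-1 in base t
-- with d(x_i) digits, the copy is labelled by the path x = y₀,y₁,…,y_d = x_i
-- in the Hasse diagram together with digits c₁,…,c_d ∈ Fin t, and its
-- "parent" copy x_{j,⌈r/t⌉} (the one it is related to) is obtained by
-- deleting the last step.  An element of P(x,t) is therefore a list
-- [(y₁,c₁),…,(y_d,c_d)] such that x,y₁,…,y_d is a path (distinct vertices,
-- consecutive ones adjacent) in the Hasse diagram.

module Blowup {n : ℕ} (_<_ : Rel (Fin n) 0ℓ) (_<?_ : Decidable _<_)
              (x : Fin n) (t : ℕ) where

  covers? : Decidable (Covers _<_)
  covers? a b = (a <? b) ×-dec ¬? (any? (λ z → (a <? z) ×-dec (z <? b)))

  adj? : Decidable (HasseAdj _<_)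
  adj? a b = covers? a b ⊎-dec covers? b a

  vertices : List (Fin n × Fin t) → List (Fin n)
  vertices l = x ∷ map proj₁ l

  isPath? : (l : List (Fin n × Fin t)) → Dec (Linked (HasseAdj _<_) (vertices l) × UP.Unique (vertices l))
  isPath? l = linked? adj? (vertices l) ×-dec UDP.unique? _≟F_ (vertices l)

  Carrier : Set
  Carrier = Σ (List (Fin n × Fin t)) λ l → True (isPath? l)

  endpoint : Carrier → Fin n
  endpoint (l , _) = lastOf _<_ x (map proj₁ l)

  Gen : Rel Carrier 0ℓ
  Gen e e′ =
    (Σ (Fin n) λ z → Σ (Fin t) λ c → (proj₁ e′ ≡ proj₁ e ++ [ (z , c) ]) × Covers _<_ (endpoint e) z)
    ⊎
    (Σ (Fin n) λ z → Σ (Fin t) λ c → (proj₁ e ≡ proj₁ e′ ++ [ (z , c) ]) × Covers _<_ z (endpoint e′))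

  _<B_ : Rel Carrier 0ℓ
  _<B_ = TransClosure Gen

{-# OPTIONS --safe #-}
-- An element of P(x,t) is a path x = y₀, y₁, …, y_d in the Hasse diagram of P with a digit attached to each
-- step, and its endpoint y_d defines a map to P. Every generating relation joins a path to a one-step
-- extension of it and is sent to a cover of P; so the endpoint map is strictly monotone and the covers of
-- P(x,t) are exactly its generating relations. Conversely, a Hasse edge of P at the endpoint of a path lifts
-- to a generating relation at that path: extend the path, or, if the new vertex is already on it, acyclicity
-- of P forces that vertex to be the penultimate one and the path is shortened. Hence chains of covers lift
-- and project preserving length. This transfers the height, and also the grading, because a maximal chain
-- is exactly a chain of covers from a minimal to a maximal element. Finally, the Hasse diagram of P(x,t) is
-- the graph of one-step extensions: it is connected through the empty path, and it has no cycles because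
-- along a non-backtracking walk the path length, once it increases, keeps increasing.
module Submission where

open import Defs
open import Level using (0ℓ)
open import Function using (flip)
open import Data.Nat using (ℕ; zero; suc; _+_; _≤_; _<_; s≤s; z≤n)
open import Data.Nat.Properties using (+-comm; ≤-refl; ≤-trans; m≤m+n; +-suc; n≮n)
import Data.Nat.Properties as ℕ
open import Data.Fin using (Fin; fromℕ<)
open import Data.Fin.Properties using (_≟_)
open import Data.Bool.Properties using (T-irrelevant)
open import Data.Product using (Σ; ∃; ∃₂; _×_; _,_; proj₁; proj₂)
open import Data.Sum using (_⊎_; inj₁; inj₂; swap; reduce)
open import Data.Empty using (⊥; ⊥-elim)
open import Data.Unit using (⊤; tt)
open import Data.List using (List; []; _∷_; length; map; _++_; [_]; _∷ʳ_; reverse; foldl)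
open import Data.List.Properties
  using (map-++; length-map; length-++; length-++-sucʳ; length-reverse; ++-assoc; ++-identityʳ; ++-conicalʳ;
         ∷ʳ-injectiveˡ)
open import Data.List.Reverse using (Reverse; reverseView; []; _∶_∶ʳ_)
open import Data.List.Membership.Propositional using (_∈_; _∉_)
open import Data.List.Membership.Propositional.Properties using (∈-++⁻; ∈-++⁺ˡ; ∈-++⁺ʳ; ∈-insert)
open import Data.List.Relation.Unary.Any using (here; there; any?)
open import Data.List.Relation.Unary.All as All using (All; []; _∷_)
import Data.List.Relation.Unary.All.Properties as AllP
open import Data.List.Relation.Unary.AllPairs as AllPairs using (AllPairs; []; _∷_)
open import Data.List.Relation.Unary.Linked as Linked using (Linked; []; [-]; _∷_)
open import Data.List.Relation.Unary.Linked.Properties using (Linked⇒AllPairs; map⁺; map⁻)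
import Data.List.Relation.Unary.Unique.Propositional as UP
import Data.List.Relation.Unary.Unique.Propositional.Properties as Unique
open import Relation.Nullary using (¬_; yes; no)
open import Relation.Nullary.Decidable using (True; toWitness; fromWitness)
open import Relation.Binary using (Rel; Transitive; Decidable; IsStrictPartialOrder)
open import Relation.Binary.PropositionalEquality
  using (_≡_; _≢_; refl; sym; trans; cong; subst; isEquivalence; resp₂; module ≡-Reasoning)
import Relation.Binary.Construct.Closure.Transitive as Plus
open import Relation.Binary.Construct.Closure.ReflexiveTransitive as Star using (Star; ε; _◅_; _◅◅_)

module _ {A : Set} {S : Rel A 0ℓ} where

  lastOf-∷ʳ : ∀ u xs z → lastOf S u (xs ∷ʳ z) ≡ z
  lastOf-∷ʳ u []       z = refl
  lastOf-∷ʳ u (y ∷ xs) z = lastOf-∷ʳ y xs z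

  lastOf-∈ : ∀ u xs → lastOf S u xs ∈ u ∷ xs
  lastOf-∈ u []       = here refl
  lastOf-∈ u (y ∷ xs) = there (lastOf-∈ y xs)

module _ {A B : Set} {R : Rel A 0ℓ} {S : Rel B 0ℓ} where

  lastOf-map : ∀ (f : A → B) u xs → f (lastOf R u xs) ≡ lastOf S (f u) (map f xs)
  lastOf-map f u []       = refl
  lastOf-map f u (y ∷ xs) = lastOf-map f y xs

module _ {A : Set} {R S : Rel A 0ℓ} where

  Linked-∷ʳ⁺ : ∀ {u xs z} → Linked R (u ∷ xs) → R (lastOf S u xs) z → Linked R (u ∷ xs ∷ʳ z)
  Linked-∷ʳ⁺ {xs = []}    [-]       r = r ∷ [-]
  Linked-∷ʳ⁺ {xs = _ ∷ _} (r′ ∷ rs) r = r′ ∷ Linked-∷ʳ⁺ rs r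

  Linked-∷ʳ⁻ : ∀ u xs {z} → Linked R (u ∷ xs ∷ʳ z) → R (lastOf S u xs) z
  Linked-∷ʳ⁻ u []       (r ∷ _)  = r
  Linked-∷ʳ⁻ u (y ∷ xs) (_ ∷ rs) = Linked-∷ʳ⁻ y xs rs

  Linked-head-last : Transitive R → ∀ {u v xs} → Linked R (u ∷ v ∷ xs) → R u (lastOf S v xs)
  Linked-head-last tr {xs = []}    (r ∷ [-]) = r
  Linked-head-last tr {xs = _ ∷ _} (r ∷ rs)  = tr r (Linked-head-last tr rs)

module _ {A : Set} {R : Rel A 0ℓ} where

  Linked-++⁻ˡ : ∀ xs {ys} → Linked R (xs ++ ys) → Linked R xs
  Linked-++⁻ˡ []           _        = []
  Linked-++⁻ˡ (_ ∷ [])     _        = [-]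
  Linked-++⁻ˡ (_ ∷ y ∷ xs) (r ∷ rs) = r ∷ Linked-++⁻ˡ (y ∷ xs) rs

  Linked-++⁻ʳ : ∀ xs {ys} → Linked R (xs ++ ys) → Linked R ys
  Linked-++⁻ʳ []       rs = rs
  Linked-++⁻ʳ (_ ∷ xs) rs = Linked-++⁻ʳ xs (Linked.tail rs)

  Linked-reverse : ∀ {xs} → Linked R xs → Linked (flip R) (reverse xs)
  Linked-reverse {[]}    []  = []
  Linked-reverse {_ ∷ _} rs = onto [-] rs
    where
    onto : ∀ {y ys acc} → Linked (flip R) (y ∷ acc) → Linked R (y ∷ ys) →
           Linked (flip R) (foldl (flip _∷_) (y ∷ acc) ys)
    onto acc [-]      = acc
    onto acc (r ∷ rs) = onto (r ∷ acc) rs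

  AllPairs-++⁻ˡ : ∀ xs {ys} → AllPairs R (xs ++ ys) → AllPairs R xs
  AllPairs-++⁻ˡ []       _        = []
  AllPairs-++⁻ˡ (_ ∷ xs) (a ∷ as) = AllP.++⁻ˡ xs a ∷ AllPairs-++⁻ˡ xs as

module _ {A : Set} {R : Rel A 0ℓ} where

  Unextendable : List A → Set
  Unextendable c = ∀ pre post z → pre ++ post ≡ c → ¬ Linked R (pre ++ z ∷ post)

  Linked-insert : ∀ pre {u v z post} → Linked R (pre ++ u ∷ v ∷ post) → R u z → R z v →
                  Linked R (pre ++ u ∷ z ∷ v ∷ post)
  Linked-insert []           (_ ∷ rs) uz zv = uz ∷ zv ∷ rs
  Linked-insert (_ ∷ [])     (r ∷ rs) uz zv = r ∷ Linked-insert [] rs uz zv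
  Linked-insert (_ ∷ p ∷ ps) (r ∷ rs) uz zv = r ∷ Linked-insert (p ∷ ps) rs uz zv

  unextendable⇒covers : ∀ {c} → Linked R c → Unextendable c → Linked (Covers R) c
  unextendable⇒covers = go []
    where
    go : ∀ pre {c} → Linked R (pre ++ c) → Unextendable (pre ++ c) → Linked (Covers R) c
    go pre {[]}        _  _  = []
    go pre {_ ∷ []}    _  _  = [-]
    go pre {u ∷ v ∷ c} ch ue = (Linked.head (Linked-++⁻ʳ pre ch) , nothing-between) ∷ go (pre ∷ʳ u) ch′ ue′
      where
      shift : ∀ ys → (pre ∷ʳ u) ++ ys ≡ pre ++ u ∷ ys
      shift ys = ++-assoc pre [ u ] ys
      nothing-between : ¬ ∃ λ z → R u z × R z v
      nothing-between (z , uz , zv) =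
        ue (pre ∷ʳ u) (v ∷ c) z (shift _) (subst (Linked R) (sym (shift _)) (Linked-insert pre ch uz zv))
      ch′ = subst (Linked R) (sym (shift _)) ch
      ue′ = subst Unextendable (sym (shift _)) ue

  longest⇒unextendable : ∀ {k c} → (∀ c′ → IsChain R c′ → length c′ ≤ k) → length c ≡ k → Unextendable c
  longest⇒unextendable {k} bounded refl pre post z refl ch =
    n≮n k (subst (_≤ k) (length-++-sucʳ pre z post) (bounded _ ch))

  unextendable⇒minimal : ∀ {h r} → Linked R (h ∷ r) → Unextendable (h ∷ r) → ∀ w → ¬ R w h
  unextendable⇒minimal ch ue w wh = ue [] _ w refl (wh ∷ ch)

  unextendable⇒maximal : ∀ {h r} → Linked R (h ∷ r) → Unextendable (h ∷ r) → ∀ w → ¬ R (lastOf R h r) w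
  unextendable⇒maximal ch ue w lw = ue _ [] w (++-identityʳ _) (Linked-∷ʳ⁺ {S = R} ch lw)

  comparable : ∀ {l a b} → AllPairs R l → a ∈ l → b ∈ l → a ≡ b ⊎ R a b ⊎ R b a
  comparable (_  ∷ _)   (here refl) (here refl) = inj₁ refl
  comparable (ab ∷ _)   (here refl) (there b∈)  = inj₂ (inj₁ (All.lookup ab b∈))
  comparable (ba ∷ _)   (there a∈)  (here refl) = inj₂ (inj₂ (All.lookup ba a∈))
  comparable (_  ∷ aps) (there a∈)  (there b∈)  = comparable aps a∈ b∈

  module _ (tr : Transitive R) where

    cover-chain⇒maximal : ∀ {h r} → Linked (Covers R) (h ∷ r) →
                          (∀ w → ¬ R w h) → (∀ w → ¬ R (lastOf R h r) w) → IsMaximalChain R (h ∷ r)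
    cover-chain⇒maximal {h} {r} covers minimal maximal = Linked.map proj₁ covers , absorb
      where
      absorb : ∀ c → IsChain R c → (∀ y → y ∈ h ∷ r → y ∈ c) → ∀ z → z ∈ c → z ∈ h ∷ r
      absorb c ch sub z z∈ = start (compare h (here refl))
        where
        compare : ∀ y → y ∈ h ∷ r → z ≡ y ⊎ R z y ⊎ R y z
        compare y y∈ = comparable (Linked⇒AllPairs tr ch) z∈ (sub y y∈)

        climb : ∀ {g s} → Linked (Covers R) (g ∷ s) → (∀ w → ¬ R (lastOf R g s) w) →
                (∀ y → y ∈ g ∷ s → z ≡ y ⊎ R z y ⊎ R y z) → R g z → z ∈ g ∷ s
        climb {s = []}     _            top _   gz = ⊥-elim (top z gz)
        climb {s = g′ ∷ s} (cov ∷ covs) top cmp gz with cmp g′ (there (here refl))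
        ... | inj₁ z≡g′       = there (here z≡g′)
        ... | inj₂ (inj₁ zg′) = ⊥-elim (proj₂ cov (z , gz , zg′))
        ... | inj₂ (inj₂ g′z) = there (climb covs top (λ y y∈ → cmp y (there y∈)) g′z)

        start : z ≡ h ⊎ R z h ⊎ R h z → z ∈ h ∷ r
        start (inj₁ z≡h)       = here z≡h
        start (inj₂ (inj₁ zh)) = ⊥-elim (minimal z zh)
        start (inj₂ (inj₂ hz)) = climb covers maximal compare hz

    module _ (irrefl : ∀ {a} → ¬ R a a) where

      Linked-insert-∉ : ∀ pre {z post} → Linked R (pre ++ z ∷ post) → z ∉ pre ++ post
      Linked-insert-∉ []        ch z∈          = irrefl (All.lookup (AllPairs.head (Linked⇒AllPairs tr ch)) z∈)
      Linked-insert-∉ (_ ∷ pre) ch (here refl) =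
        irrefl (All.lookup (AllPairs.head (Linked⇒AllPairs tr ch)) (∈-insert pre))
      Linked-insert-∉ (_ ∷ pre) ch (there z∈)  = Linked-insert-∉ pre (Linked.tail ch) z∈

      maximal⇒unextendable : ∀ {c} → IsMaximalChain R c → Unextendable c
      maximal⇒unextendable (_ , maximal) pre post z refl ch =
        Linked-insert-∉ pre ch (maximal _ ch widen z (∈-insert pre))
        where
        widen : ∀ y → y ∈ pre ++ post → y ∈ pre ++ z ∷ post
        widen y y∈ with ∈-++⁻ pre y∈
        ... | inj₁ y∈pre  = ∈-++⁺ˡ y∈pre
        ... | inj₂ y∈post = ∈-++⁺ʳ pre (there y∈post)

module _ {A : Set} {R : Rel A 0ℓ} {k : ℕ} (bounded : ∀ c → IsChain R c → length c ≤ k) where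

  uncovered⇒maximal : ∀ {y} → (∀ z → ¬ Covers R y z) → ∀ w → ¬ R y w
  uncovered⇒maximal {y} uncovered w yw = climb k [] (yw ∷ [-]) (m≤m+n k 1)
    where
    -- Each refinement of y < w lengthens the chain y < w < above; the height bound k serves as fuel.
    climb : ∀ fuel {w} above → Linked R (y ∷ w ∷ above) → k ≤ fuel + length (w ∷ above) → ⊥
    climb zero           above ch        k≤ = n≮n k (≤-trans (s≤s k≤) (bounded _ ch))
    climb (suc fuel) {w} above (yw ∷ ch) k≤ = uncovered w (yw , λ (z , yz , zw) →
      climb fuel (w ∷ above) (yz ∷ zw ∷ ch) (subst (k ≤_) (sym (+-suc fuel (length (w ∷ above)))) k≤))

module _ {A : Set} {R : Rel A 0ℓ} {k : ℕ} (bounded : ∀ c → IsChain R c → length c ≤ k) where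

  uncovered⇒minimal : ∀ {y} → (∀ z → ¬ Covers R z y) → ∀ w → ¬ R w y
  uncovered⇒minimal {y} uncovered = uncovered⇒maximal {R = flip R} bounded-dual uncovered-dual
    where
    bounded-dual : ∀ c → IsChain (flip R) c → length c ≤ k
    bounded-dual c ch = subst (_≤ k) (length-reverse c) (bounded (reverse c) (Linked-reverse ch))
    uncovered-dual : ∀ z → ¬ Covers (flip R) y z
    uncovered-dual z (zy , nothing-between) = uncovered z (zy , λ (m , zm , my) → nothing-between (m , my , zm))

module _ {A : Set} {R : Rel A 0ℓ} where

  Star⇒walk : ∀ {u v} → Star (HasseAdj R) u v → Σ (List A) λ l → Linked (HasseAdj R) (u ∷ l) × lastOf R u l ≡ v
  Star⇒walk ε = [] , [-] , refl
  Star⇒walk (adj ◅ walk) with Star⇒walk walk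
  ... | l , ch , end = _ ∷ l , adj ∷ ch , end

  connected-via : (root : A) → (∀ a → Star (HasseAdj R) root a) → HasseConnected R
  connected-via root reach u v = Star⇒walk (Star.reverse swap (reach u) ◅◅ reach v)

  module _ (irrefl : ∀ {a} → ¬ R a a) (acyclic : ∀ l → ¬ IsCycle R l) where

    path-neighbour-is-penultimate : ∀ {q} u vs → Linked (HasseAdj R) (u ∷ vs) → UP.Unique (u ∷ vs) →
      q ∈ u ∷ vs → HasseAdj R (lastOf R u vs) q → ∃ λ vs′ → vs ≡ vs′ ∷ʳ lastOf R u vs × lastOf R u vs′ ≡ q
    path-neighbour-is-penultimate u []           _  _  (here refl) adj = ⊥-elim (irrefl (proj₁ (reduce adj)))
    path-neighbour-is-penultimate u (v ∷ [])     _  _  (here refl) _   = [] , refl , refl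
    path-neighbour-is-penultimate u (v ∷ w ∷ vs) ch un (here refl) adj =
      ⊥-elim (acyclic _ (s≤s (s≤s (s≤s z≤n)) , ch , un , u , _ , refl , adj))
    path-neighbour-is-penultimate u (v ∷ vs) (_ ∷ ch) (_ ∷ un) (there q∈) adj
      with path-neighbour-is-penultimate v vs ch un q∈ adj
    ... | vs′ , split , end = v ∷ vs′ , cong (v ∷_) split , end

module Forest {A : Set} (Child : Rel A 0ℓ) (depth : A → ℕ)
  (depth-child : ∀ {e f} → Child e f → depth f ≡ suc (depth e))
  (parent-unique : ∀ {e f g} → Child e f → Child g f → e ≡ g) where

  Edge : Rel A 0ℓ
  Edge e f = Child e f ⊎ Child f e

  NonBacktracking : List A → Set
  NonBacktracking (a ∷ b ∷ c ∷ w) = a ≢ c × NonBacktracking (b ∷ c ∷ w)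
  NonBacktracking _               = ⊤

  LastStep : Rel A 0ℓ → List A → Set
  LastStep T (a ∷ b ∷ [])    = T a b
  LastStep T (a ∷ b ∷ c ∷ w) = LastStep T (b ∷ c ∷ w)
  LastStep T _               = ⊥

  child-deeper : ∀ {e f} → Child e f → depth e < depth f
  child-deeper c = subst (depth _ <_) (sym (depth-child c)) ≤-refl

  not-mutual-children : ∀ {e f} → Child e f → ¬ Child f e
  not-mutual-children c c′ = n≮n _ (ℕ.<-trans (child-deeper c) (child-deeper c′))

  ascent-continues : ∀ {a b w} → Linked Edge (a ∷ b ∷ w) → NonBacktracking (a ∷ b ∷ w) → Child a b →
                     Linked Child (a ∷ b ∷ w)
  ascent-continues {w = []}    _                   _         ab = ab ∷ [-]
  ascent-continues {w = _ ∷ _} (_ ∷ inj₁ bc ∷ es) (_ , nb)  ab = ab ∷ ascent-continues (inj₁ bc ∷ es) nb bc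
  ascent-continues {w = _ ∷ _} (_ ∷ inj₂ cb ∷ _)  (a≢c , _) ab = ⊥-elim (a≢c (parent-unique ab cb))

  last-step-both : ∀ {T U : Rel A 0ℓ} {w} → Linked T w → LastStep U w → ∃₂ λ a b → T a b × U a b
  last-step-both {w = _ ∷ _ ∷ []}    (t ∷ [-]) u = _ , _ , t , u
  last-step-both {w = _ ∷ _ ∷ _ ∷ _} (_ ∷ ts)  u = last-step-both ts u

  descent-from-start : ∀ {w} → Linked Edge w → NonBacktracking w → LastStep (flip Child) w → Linked (flip Child) w
  descent-from-start {_ ∷ _ ∷ []}    (inj₂ ba ∷ _)    _        _    = ba ∷ [-]
  descent-from-start {_ ∷ _ ∷ _ ∷ _} (inj₂ ba ∷ es)   (_ , nb) down = ba ∷ descent-from-start es nb down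
  descent-from-start {_ ∷ _ ∷ _}     es@(inj₁ ab ∷ _) nb       down
    with last-step-both (ascent-continues es nb ab) down
  ... | _ , _ , up , down′ = ⊥-elim (not-mutual-children up down′)

  NonBacktracking-∷ʳ : ∀ {s u} → UP.Unique s → All (_≢ u) s → NonBacktracking (s ∷ʳ u)
  NonBacktracking-∷ʳ {[]}            _                    _         = tt
  NonBacktracking-∷ʳ {_ ∷ []}        _                    _         = tt
  NonBacktracking-∷ʳ {_ ∷ _ ∷ []}    _                    (a≢u ∷ _) = a≢u , tt
  NonBacktracking-∷ʳ {_ ∷ _ ∷ _ ∷ _} ((_ ∷ a≢c ∷ _) ∷ un) (_ ∷ ne)  = a≢c , NonBacktracking-∷ʳ un ne

  LastStep-∷ʳ : ∀ {S T : Rel A 0ℓ} a s {u} → T (lastOf S a s) u → LastStep T (a ∷ s ∷ʳ u)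
  LastStep-∷ʳ     a []          t = t
  LastStep-∷ʳ     a (b ∷ [])    t = t
  LastStep-∷ʳ {S} a (b ∷ c ∷ s) t = LastStep-∷ʳ {S} b (c ∷ s) t

  -- Close the cycle v₁ … v_m into the walk v₁ … v_m v₁. If it starts by going to a child it keeps doing so
  -- and returns deeper; otherwise v₂ is the parent of v₁, so v_m cannot be (it differs from v₂): the walk
  -- ends by going to a parent, hence it went to parents throughout and returns shallower.
  closed-path-impossible : ∀ {S : Rel A 0ℓ} v₁ r → 3 ≤ length (v₁ ∷ r) → Linked Edge (v₁ ∷ r) →
                           UP.Unique (v₁ ∷ r) → ¬ Edge (lastOf S v₁ r) v₁
  closed-path-impossible v₁ []       (s≤s ())
  closed-path-impossible v₁ (_ ∷ []) (s≤s (s≤s ()))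
  closed-path-impossible {S} v₁ (v₂ ∷ v₃ ∷ r) _ es (v₁∉ ∷ v₂∉ ∷ un) closing = go (Linked.head es) closing
    where
    walk : Linked Edge (v₁ ∷ v₂ ∷ v₃ ∷ r ∷ʳ v₁)
    walk = Linked-∷ʳ⁺ {S = S} es closing
    nb : NonBacktracking (v₁ ∷ v₂ ∷ v₃ ∷ r ∷ʳ v₁)
    nb = All.head (All.tail v₁∉) , NonBacktracking-∷ʳ (v₂∉ ∷ un) (All.map (λ ne eq → ne (sym eq)) v₁∉)
    returns : depth (lastOf S v₂ (v₃ ∷ r ∷ʳ v₁)) ≡ depth v₁
    returns = cong depth (lastOf-∷ʳ {S = S} v₂ (v₃ ∷ r) v₁)
    go : Edge v₁ v₂ → ¬ Edge (lastOf S v₃ r) v₁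
    go (inj₁ up) _ = n≮n (depth v₁) (subst (depth v₁ <_) returns
      (Linked-head-last {S = S} ℕ.<-trans (Linked.map child-deeper (ascent-continues walk nb up))))
    go (inj₂ down) (inj₁ up) = All.lookup v₂∉ (lastOf-∈ {S = S} v₃ r) (sym (parent-unique up down))
    go (inj₂ down) (inj₂ down′) = n≮n (depth v₁) (subst (_< depth v₁) returns
      (Linked-head-last {S = S} (flip ℕ.<-trans)
        (Linked.map child-deeper (descent-from-start walk nb (LastStep-∷ʳ {S} v₁ (v₂ ∷ v₃ ∷ r) down′)))))

  acyclic : ∀ {_≺_ : Rel A 0ℓ} → (∀ {e f} → HasseAdj _≺_ e f → Edge e f) → ∀ l → ¬ IsCycle _≺_ l
  acyclic {_≺_} edge _ (long , ch , un , v₁ , r , refl , closing) =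
    closed-path-impossible {S = _≺_} v₁ r long (Linked.map edge ch) un (edge closing)

module BlowupProperties {n : ℕ} (_<_ : Rel (Fin n) 0ℓ) (_<?_ : Decidable _<_) (x : Fin n) (t : ℕ) where

  open Blowup _<_ _<?_ x t

  Carrier-≡ : ∀ {e f : Carrier} → proj₁ e ≡ proj₁ f → e ≡ f
  Carrier-≡ {l , p} {.l , q} refl = cong (l ,_) (T-irrelevant p q)

  root : Carrier
  root = [] , _

  depth : Carrier → ℕ
  depth e = length (proj₁ e)

  record Child (e f : Carrier) : Set where
    constructor child
    field
      entry   : Fin n × Fin t
      extends : proj₁ f ≡ proj₁ e ∷ʳ entry

  depth-child : ∀ {e f} → Child e f → depth f ≡ suc (depth e)
  depth-child {e} (child y refl) = trans (length-++ (proj₁ e)) (+-comm _ 1)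

  parent-unique : ∀ {e f g} → Child e f → Child g f → e ≡ g
  parent-unique {e} {f} {g} (child y f≡) (child y′ f≡′) =
    Carrier-≡ (∷ʳ-injectiveˡ (proj₁ e) (proj₁ g) (trans (sym f≡) f≡′))

  open Forest Child depth depth-child parent-unique using (Edge; acyclic)

  vertices-∷ʳ : ∀ l y → vertices (l ∷ʳ y) ≡ vertices l ∷ʳ proj₁ y
  vertices-∷ʳ l y = cong (x ∷_) (map-++ proj₁ l [ y ])

  endpoint-∷ʳ : ∀ (l : List (Fin n × Fin t)) y → lastOf _<_ x (map proj₁ (l ∷ʳ y)) ≡ proj₁ y
  endpoint-∷ʳ l y = trans (cong (lastOf _<_ x) (map-++ proj₁ l [ y ])) (lastOf-∷ʳ {S = _<_} x (map proj₁ l) (proj₁ y))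

  endpoint-child : ∀ {e f} (c : Child e f) → endpoint f ≡ proj₁ (Child.entry c)
  endpoint-child {e} (child y refl) = endpoint-∷ʳ (proj₁ e) y

  parent-path : ∀ {l y} → True (isPath? (l ∷ʳ y)) → True (isPath? l)
  parent-path {l} {y} p with toWitness p
  ... | ch , un = fromWitness (Linked-++⁻ˡ (vertices l) (subst (Linked (HasseAdj _<_)) (vertices-∷ʳ l y) ch) ,
                               AllPairs-++⁻ˡ (vertices l) (subst UP.Unique (vertices-∷ʳ l y) un))

  child⇒endpoints-adjacent : ∀ {e f} → Child e f → HasseAdj _<_ (endpoint e) (endpoint f)
  child⇒endpoints-adjacent {l , _} {_ , p} c@(child y refl) = subst (HasseAdj _<_ _) (sym (endpoint-child c))
    (Linked-∷ʳ⁻ {S = _<_} x (map proj₁ l) (subst (Linked (HasseAdj _<_)) (vertices-∷ʳ l y) (proj₁ (toWitness p))))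

  edge⇒endpoints-adjacent : ∀ {e f} → Edge e f → HasseAdj _<_ (endpoint e) (endpoint f)
  edge⇒endpoints-adjacent (inj₁ c) = child⇒endpoints-adjacent c
  edge⇒endpoints-adjacent (inj₂ c) = swap (child⇒endpoints-adjacent c)

  Gen⇒edge : ∀ {e f} → Gen e f → Edge e f
  Gen⇒edge (inj₁ (z , i , f≡ , _)) = inj₁ (child (z , i) f≡)
  Gen⇒edge (inj₂ (z , i , e≡ , _)) = inj₂ (child (z , i) e≡)

  Gen⇒covers : ∀ {e f} → Gen e f → Covers _<_ (endpoint e) (endpoint f)
  Gen⇒covers {e} {f} (inj₁ (z , i , f≡ , cov)) =
    subst (Covers _<_ _) (sym (endpoint-child {e} {f} (child (z , i) f≡))) cov
  Gen⇒covers {e} {f} (inj₂ (z , i , e≡ , cov)) =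
    subst (λ w → Covers _<_ w _) (sym (endpoint-child {f} {e} (child (z , i) e≡))) cov

  edge∧covers⇒Gen : ∀ {e f} → Edge e f → Covers _<_ (endpoint e) (endpoint f) → Gen e f
  edge∧covers⇒Gen (inj₁ c@(child (z , i) f≡)) cov = inj₁ (z , i , f≡ , subst (Covers _<_ _) (endpoint-child c) cov)
  edge∧covers⇒Gen (inj₂ c@(child (z , i) e≡)) cov =
    inj₂ (z , i , e≡ , subst (λ w → Covers _<_ w _) (endpoint-child c) cov)

  root-reaches : ∀ e → Star Edge root e
  root-reaches (l , p) = go (reverseView l) p
    where
    go : ∀ {l} → Reverse l → (p : True (isPath? l)) → Star Edge root (l , p)
    go []             _ = ε
    go (_ ∶ rl ∶ʳ y) p = go rl (parent-path p) ◅◅ (inj₁ (child y refl) ◅ ε)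

  module Ordered (<-strict : IsStrictPartialOrder _≡_ _<_) where

    open IsStrictPartialOrder <-strict using () renaming (irrefl to <-irrefl; trans to <-trans)

    endpoint-mono : ∀ {e f} → e <B f → endpoint e < endpoint f
    endpoint-mono {e} {f} Plus.[ g ]                  = proj₁ (Gen⇒covers {e} {f} g)
    endpoint-mono {e}     (Plus._∷_ {y = m} g m<B) = <-trans (proj₁ (Gen⇒covers {e} {m} g)) (endpoint-mono m<B)

    Gen⇒⋖ : ∀ {e f} → Gen e f → Covers _<B_ e f
    Gen⇒⋖ {e} {f} g = Plus.[ g ] , λ (m , e<m , m<f) →
      proj₂ (Gen⇒covers {e} {f} g) (endpoint m , endpoint-mono e<m , endpoint-mono m<f)

    ⋖⇒Gen : ∀ {e f} → Covers _<B_ e f → Gen e f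
    ⋖⇒Gen (Plus.[ g ]       , _)               = g
    ⋖⇒Gen (g Plus.∷ m<B , nothing-between) = ⊥-elim (nothing-between (_ , Plus.[ g ] , m<B))

    <B-irreflexive : ∀ {e} → ¬ e <B e
    <B-irreflexive e<e = <-irrefl refl (endpoint-mono e<e)

    <B-isStrictPartialOrder : IsStrictPartialOrder _≡_ _<B_
    <B-isStrictPartialOrder = record
      { isEquivalence = isEquivalence
      ; irrefl        = λ { refl → <B-irreflexive }
      ; trans         = Plus.transitive Gen
      ; <-resp-≈      = resp₂ _<B_
      }

    adjacent⇒edge : ∀ {e f} → HasseAdj _<B_ e f → Edge e f
    adjacent⇒edge (inj₁ e⋖f) = Gen⇒edge (⋖⇒Gen e⋖f)
    adjacent⇒edge (inj₂ f⋖e) = swap (Gen⇒edge (⋖⇒Gen f⋖e))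

    edge⇒adjacent : ∀ {e f} → Edge e f → HasseAdj _<B_ e f
    edge⇒adjacent edge with edge⇒endpoints-adjacent edge
    ... | inj₁ e⋖f = inj₁ (Gen⇒⋖ (edge∧covers⇒Gen edge e⋖f))
    ... | inj₂ f⋖e = inj₂ (Gen⇒⋖ (edge∧covers⇒Gen (swap edge) f⋖e))

    <B-isTreePoset : IsTreePoset _<B_
    <B-isTreePoset = root , connected-via root (λ e → Star.map edge⇒adjacent (root-reaches e)) , acyclic adjacent⇒edge

    module Lifting (P-connected : HasseConnected _<_) (P-acyclic : ∀ l → ¬ IsCycle _<_ l) (digit : Fin t) where

      parent-ending-at : ∀ {l} (p : True (isPath? l)) {vs′ z q} → map proj₁ l ≡ vs′ ∷ʳ z → lastOf _<_ x vs′ ≡ q →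
                         ∃ λ f → endpoint f ≡ q × Child f (l , p)
      parent-ending-at {l} p {vs′} {z} split penultimate = go (reverseView l) p split
        where
        go : ∀ {l} → Reverse l → (p : True (isPath? l)) → map proj₁ l ≡ vs′ ∷ʳ z →
             ∃ λ f → endpoint f ≡ _ × Child f (l , p)
        go [] _ split with ++-conicalʳ vs′ [ z ] (sym split)
        ... | ()
        go (l′ ∶ _ ∶ʳ y) p split = (l′ , parent-path p) , trans (cong (lastOf _<_ x) init≡) penultimate , child y refl
          where
          init≡ : map proj₁ l′ ≡ vs′
          init≡ = ∷ʳ-injectiveˡ (map proj₁ l′) vs′ (trans (sym (map-++ proj₁ l′ [ y ])) split)

      neighbour : ∀ e q → HasseAdj _<_ (endpoint e) q → ∃ λ f → endpoint f ≡ q × Edge e f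
      neighbour (l , p) q adj with any? (q ≟_) (vertices l) | toWitness p
      ... | no q∉ | ch , un =
        (l ∷ʳ (q , digit) , fromWitness (ch′ , un′)) , endpoint-∷ʳ l (q , digit) , inj₁ (child (q , digit) refl)
        where
        ch′ = subst (Linked (HasseAdj _<_)) (sym (vertices-∷ʳ l (q , digit))) (Linked-∷ʳ⁺ {S = _<_} ch adj)
        un′ = subst UP.Unique (sym (vertices-∷ʳ l (q , digit)))
                    (Unique.++⁺ un ([] ∷ []) λ { (q∈ , here refl) → q∉ q∈ })
      ... | yes q∈ | ch , un with path-neighbour-is-penultimate (<-irrefl refl) P-acyclic x (map proj₁ l) ch un q∈ adj
      ...   | vs′ , split , penultimate with parent-ending-at p split penultimate
      ...     | f , end , c = f , end , inj₂ c

      lift-walk : ∀ e r → Linked (HasseAdj _<_) (endpoint e ∷ r) →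
                  ∃ λ es → Linked Edge (e ∷ es) × map endpoint es ≡ r
      lift-walk e []      _          = [] , [-] , refl
      lift-walk e (q ∷ r) (adj ∷ ch) with neighbour e q adj
      ... | f , refl , edge with lift-walk f r ch
      ...   | es , edges , refl = f ∷ es , edge ∷ edges , refl

      endpoint-surjective : ∀ p → ∃ λ e → endpoint e ≡ p
      endpoint-surjective p with P-connected x p
      ... | w , ch , end with lift-walk root w ch
      ...   | es , _ , refl = lastOf _<B_ root es , trans (lastOf-map {R = _<B_} {S = _<_} endpoint root es) end

      lift-cover-chain : ∀ {p r} → Linked (Covers _<_) (p ∷ r) → ∃ λ c → IsChain _<B_ c × length c ≡ length (p ∷ r)
      lift-cover-chain {p} {r} covers with endpoint-surjective p
      ... | e , refl with lift-walk e r (Linked.map inj₁ covers)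
      ...   | es , edges , refl =
        e ∷ es ,
        Linked.map Plus.[_] (Linked.zipWith (λ (edge , cov) → edge∧covers⇒Gen edge cov) (edges , map⁻ covers)) ,
        cong suc (sym (length-map endpoint es))

      module OfHeight {k} (height : HasHeight _<_ k) where

        <B-bounded : ∀ c → IsChain _<B_ c → length c ≤ k
        <B-bounded c ch =
          subst (_≤ k) (length-map endpoint c) (proj₂ height (map endpoint c) (map⁺ (Linked.map endpoint-mono ch)))

        <B-height : HasHeight _<B_ k
        <B-height = lift-longest (proj₁ height) , <B-bounded
          where
          lift-longest : (∃ λ c → IsChain _<_ c × length c ≡ k) → ∃ λ c → IsChain _<B_ c × length c ≡ k
          lift-longest ([]    , _  , len) = [] , [] , len
          lift-longest (_ ∷ _ , ch , len)
            with lift-cover-chain (unextendable⇒covers ch (longest⇒unextendable (proj₂ height) len))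
          ... | c , chB , len′ = c , chB , trans len′ len

        maximal-chain-projects : ∀ {c} → IsMaximalChain _<B_ c → IsMaximalChain _<_ (map endpoint c)
        maximal-chain-projects {[]} (_ , maximal) with maximal [ root ] [-] (λ _ ()) root (here refl)
        ... | ()
        maximal-chain-projects {h ∷ r} max@(ch , _) = cover-chain⇒maximal <-trans covers bottom top
          where
          ue : Unextendable (h ∷ r)
          ue = maximal⇒unextendable (Plus.transitive Gen) <B-irreflexive max
          covers : Linked (Covers _<_) (map endpoint (h ∷ r))
          covers = map⁺ (Linked.map (λ {e} {f} e⋖f → Gen⇒covers {e} {f} (⋖⇒Gen e⋖f)) (unextendable⇒covers ch ue))
          bottom : ∀ w → ¬ w < endpoint h
          bottom = uncovered⇒minimal (proj₂ height) uncovered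
            where
            uncovered : ∀ z → ¬ Covers _<_ z (endpoint h)
            uncovered z z⋖h with neighbour h z (inj₂ z⋖h)
            ... | f , refl , edge = unextendable⇒minimal ch ue f Plus.[ edge∧covers⇒Gen (swap edge) z⋖h ]
          top : ∀ w → ¬ lastOf _<_ (endpoint h) (map endpoint r) < w
          top = subst (λ l → ∀ w → ¬ l < w) (lastOf-map {R = _<B_} {S = _<_} endpoint h r)
                      (uncovered⇒maximal (proj₂ height) uncovered)
            where
            uncovered : ∀ z → ¬ Covers _<_ (endpoint (lastOf _<B_ h r)) z
            uncovered z l⋖z with neighbour (lastOf _<B_ h r) z (inj₁ l⋖z)
            ... | f , refl , edge = unextendable⇒maximal ch ue f Plus.[ edge∧covers⇒Gen edge l⋖z ]

        <B-graded : IsGraded _<_ → IsGraded _<B_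
        <B-graded graded c c′ max max′ = begin
          length c                 ≡⟨ length-map endpoint c ⟨
          length (map endpoint c)  ≡⟨ graded _ _ (maximal-chain-projects max) (maximal-chain-projects max′) ⟩
          length (map endpoint c′) ≡⟨ length-map endpoint c′ ⟩
          length c′                ∎
          where open ≡-Reasoning

lemma2p6 : (n : ℕ) (_<_ : Rel (Fin n) 0ℓ) (_<?_ : Decidable _<_) (k : ℕ) (x : Fin n) (a : ℕ) →
    1 ≤ a →
    IsGradedTreePosetOfHeight _<_ k →
    IsGradedTreePosetOfHeight (Blowup._<B_ _<_ _<?_ x a) k
lemma2p6 n _<_ _<?_ k x a 1≤a (strict , (_ , connected , acyclic) , graded , height) =
  <B-isStrictPartialOrder , <B-isTreePoset , <B-graded graded , <B-height
  where
  open BlowupProperties _<_ _<?_ x a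
  open Ordered strict
  open Lifting connected acyclic (fromℕ< 1≤a)
  open OfHeight height
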